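{- Let $n\in\mathbb{N}$ and let $u$ be a formal variable. Define $h(x;u)=\sum_{j=0}^{\lfloor n/2\rfloor}u^jx^j(1+x)^{n-2j}$ and let $h_i\in\mathbb{Z}[u]$ be the coefficient of $x^i$ in $h(x;u)$, i.e. $h_i=\sum_{j=0}^{\min(i,\lfloor n/2\rfloor)}\binom{n-2j}{i-j}u^j$ (this is the symmetric polynomial with center $n/2$ whose $\gamma$-polynomial is $\sum_{j=0}^{\lfloor n/2\rfloor}u^jx^j$). Then for every $1\le i\le\lfloor n/2\rfloor$ and every integer $r\ge 0$, the coefficient of $u^r$ in $h_i^2-h_{i-1}h_{i+1}$ is nonnegative.
   Context: Binomial coefficients $\binom{a}{b}$ with integer $a\ge 0$ are taken to be $0$ unless $0\le b\le a$. -}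

module Defs where

open import Data.Nat using (ℕ; zero; suc; _+_; _*_; _∸_; _≤ᵇ_; _/_)
open import Data.Nat.Combinatorics using (_C_)
open import Data.Bool using (if_then_else_; _∧_)
open import Data.Integer using (ℤ; +_; _-_)
open import Data.List using (List; map; upTo)
import Data.Integer as ℤ
open import Data.List using (foldr)

-- Polynomials in u with integer coefficients are represented by their
-- coefficient functions ℕ → ℤ (coefficient of u^j).

-- Binomial coefficient with the paper's convention: binom a b for
-- integer b = i - j, which is 0 unless 0 ≤ i - j ≤ a.
-- binomZ a i j = binom(a, i - j)  (i - j taken as an integer)
binomZ : ℕ → ℕ → ℕ → ℕ
binomZ a i j = if j ≤ᵇ i then a C (i ∸ j) else 0
-- (Data.Nat.Combinatorics._C_ already returns 0 when i - j > a.)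

hCoef : (n i j : ℕ) → ℤ
hCoef n i j =
  if (j ≤ᵇ i) ∧ (j ≤ᵇ n / 2) then + binomZ (n ∸ 2 * j) i j else + 0

sumTo : ℕ → (ℕ → ℤ) → ℤ
sumTo r f = foldr ℤ._+_ (+ 0) (map f (upTo (suc r)))

convCoef : (ℕ → ℤ) → (ℕ → ℤ) → ℕ → ℤ
convCoef p q r = sumTo r (λ a → p a ℤ.* q (r ∸ a))

lcCoef : (n i r : ℕ) → ℤ
lcCoef n i r = convCoef (hCoef n i) (hCoef n i) r
               - convCoef (hCoef n (i ∸ 1)) (hCoef n (suc i)) r

module Submission where

open import Defs
open import Data.Nat using (ℕ; _≤_; _/_)
open import Data.Integer using (+_) renaming (_≤_ to _≤ℤ_)

open import Data.Nat using (zero; suc; _+_; _*_; _∸_; _≤ᵇ_; _<_; z≤n; s≤s; _≤?_)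
open import Data.Nat.Properties
open import Data.Nat.Combinatorics using (_C_; nCk+nC[k+1]≡[n+1]C[k+1]; nC1≡n)
open import Data.Nat.DivMod using (m/n*n≤m)
open import Data.Nat.Tactic.RingSolver using (solve-∀)
open import Data.Bool using (true; false; T; _∧_; if_then_else_)
open import Data.Unit using (tt)
open import Data.Empty using (⊥-elim)
open import Data.Product using (_,_)
open import Data.List using (map; foldr; applyUpTo)
open import Function using (_∘_)
open import Relation.Nullary using (yes; no)
open import Relation.Binary.PropositionalEquality
import Data.Integer as ℤ
import Data.Integer.Properties as ℤ

-- Let X_k and Y_k be the coefficients of u^r in h_k² and h_{k-1} h_{k+1}, with
-- the cutoff j ≤ ⌊n/2⌋ dropped (it only lowers Y_k, and X_k is unchanged for
-- 2k ≤ n).  Expanding C(n+2-2a, ·) by Pascal's rule twice and telescoping over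
-- the convolution index leaves only two boundary terms:
--   (X_k - Y_k) - (X_{k-1} - Y_{k-1}) = C(n+2,k) C(n-2r,k-r) - C(n+2,k+1) C(n-2r,k-r-1).
-- For 2k ≤ n this is nonnegative, by comparing the ratios C(N,k+1)/C(N,k) = (N-k)/(k+1)
-- of consecutive binomial coefficients, so X_k - Y_k ≥ X_0 - Y_0 = X_0 ≥ 0.

∑< : ℕ → (ℕ → ℕ) → ℕ
∑< zero    f = 0
∑< (suc m) f = f 0 + ∑< m (f ∘ suc)

∑<-cong : ∀ m {f g : ℕ → ℕ} → (∀ a → f a ≡ g a) → ∑< m f ≡ ∑< m g
∑<-cong zero    f≡g = refl
∑<-cong (suc m) f≡g = cong₂ _+_ (f≡g 0) (∑<-cong m (f≡g ∘ suc))

∑<-mono-≤ : ∀ m {f g : ℕ → ℕ} → (∀ a → f a ≤ g a) → ∑< m f ≤ ∑< m g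
∑<-mono-≤ zero    f≤g = z≤n
∑<-mono-≤ (suc m) f≤g = +-mono-≤ (f≤g 0) (∑<-mono-≤ m (f≤g ∘ suc))

∑<-distrib-+ : ∀ m (f g : ℕ → ℕ) → ∑< m (λ a → f a + g a) ≡ ∑< m f + ∑< m g
∑<-distrib-+ zero    f g = refl
∑<-distrib-+ (suc m) f g =
  trans (cong (_+_ (f 0 + g 0)) (∑<-distrib-+ m (f ∘ suc) (g ∘ suc)))
        (+-interchange (f 0) (g 0) _ _)
  where
  +-interchange : ∀ a b c d → a + b + (c + d) ≡ a + c + (b + d)
  +-interchange = solve-∀

∑<-telescope : ∀ m (f g ω ω′ : ℕ → ℕ) →
               (∀ a → f a + ω a ≡ g a + ω′ a) → (∀ a → a < m → ω′ a ≡ ω (suc a)) →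
               ∑< (suc m) f + ω 0 ≡ ∑< (suc m) g + ω′ m
∑<-telescope zero f g ω ω′ step _ =
  trans (cong (_+ ω 0) (+-identityʳ (f 0)))
        (trans (step 0) (cong (_+ ω′ 0) (sym (+-identityʳ (g 0)))))
∑<-telescope (suc m) f g ω ω′ step shift = begin
    f 0 + F + ω 0     ≡⟨ rotate (f 0) F (ω 0) ⟩
    F + (f 0 + ω 0)   ≡⟨ cong (_+_ F) (trans (step 0) (cong (_+_ (g 0)) (shift 0 (s≤s z≤n)))) ⟩
    F + (g 0 + ω 1)   ≡⟨ swap F (g 0) (ω 1) ⟩
    g 0 + (F + ω 1)   ≡⟨ cong (_+_ (g 0)) rest ⟩
    g 0 + (G + ω′ (suc m)) ≡⟨ sym (+-assoc (g 0) G _) ⟩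
    g 0 + G + ω′ (suc m) ∎
  where
  open ≡-Reasoning
  F = ∑< (suc m) (f ∘ suc)
  G = ∑< (suc m) (g ∘ suc)
  rest : F + ω 1 ≡ G + ω′ (suc m)
  rest = ∑<-telescope m (f ∘ suc) (g ∘ suc) (ω ∘ suc) (ω′ ∘ suc)
           (step ∘ suc) (λ a a<m → shift (suc a) (s≤s a<m))
  rotate : ∀ a b c → a + b + c ≡ b + (a + c)
  rotate = solve-∀
  swap : ∀ a b c → a + (b + c) ≡ b + (a + c)
  swap = solve-∀

convℕ : (ℕ → ℕ) → (ℕ → ℕ) → ℕ → ℕ
convℕ f g r = ∑< (suc r) (λ a → f a * g (r ∸ a))

binomZ-suc-suc : ∀ M i j → binomZ M (suc i) (suc j) ≡ binomZ M i j
binomZ-suc-suc M i zero    = refl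
binomZ-suc-suc M i (suc j) = refl

binomZ-< : ∀ M {i j} → i < j → binomZ M i j ≡ 0
binomZ-< M {zero}  {suc j} _         = refl
binomZ-< M {suc i} {suc j} (s≤s i<j) = trans (binomZ-suc-suc M i j) (binomZ-< M i<j)

binomZ-+ : ∀ M j t → binomZ M (j + t) j ≡ M C t
binomZ-+ M zero    t = refl
binomZ-+ M (suc j) t = trans (binomZ-suc-suc M (j + t) j) (binomZ-+ M j t)

binomZ-top-irrelevant : ∀ M M′ {i j} → i ≤ j → binomZ M i j ≡ binomZ M′ i j
binomZ-top-irrelevant M M′ {zero}  {zero}  _         = refl
binomZ-top-irrelevant M M′ {zero}  {suc j} _         = refl
binomZ-top-irrelevant M M′ {suc i} {suc j} (s≤s i≤j) =
  trans (binomZ-suc-suc M i j) (trans (binomZ-top-irrelevant M M′ i≤j) (sym (binomZ-suc-suc M′ i j)))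

binomZ-pascal : ∀ M i j → binomZ M i j + binomZ M i (suc j) ≡ binomZ (suc M) i j
binomZ-pascal M zero    zero    = refl
binomZ-pascal M (suc i) zero    = trans (+-comm (M C suc i) (M C i)) (nCk+nC[k+1]≡[n+1]C[k+1] M i)
binomZ-pascal M zero    (suc j) = refl
binomZ-pascal M (suc i) (suc j)
  rewrite binomZ-suc-suc M i j | binomZ-suc-suc M i (suc j) | binomZ-suc-suc (suc M) i j =
  binomZ-pascal M i j

binomZ-pascal² : ∀ M i j →
  binomZ M i j + (binomZ M i (suc j) + binomZ M i (suc j)) + binomZ M i (suc (suc j))
  ≡ binomZ (suc (suc M)) i j
binomZ-pascal² M i j = begin
    b j + (b (suc j) + b (suc j)) + b (suc (suc j))
  ≡⟨ regroup (b j) (b (suc j)) (b (suc (suc j))) ⟩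
    (b j + b (suc j)) + (b (suc j) + b (suc (suc j)))
  ≡⟨ cong₂ _+_ (binomZ-pascal M i j) (binomZ-pascal M i (suc j)) ⟩
    binomZ (suc M) i j + binomZ (suc M) i (suc j)
  ≡⟨ binomZ-pascal (suc M) i j ⟩
    binomZ (suc (suc M)) i j
  ∎
  where
  open ≡-Reasoning
  b = binomZ M i
  regroup : ∀ x y z → x + (y + y) + z ≡ (x + y) + (y + z)
  regroup = solve-∀

-- With a truncated top n ∸ 2c the recurrence n - 2c = (n - 2(c+1)) + 2 fails once
-- 2(c+1) > n; but then 2i ≤ n + 2 forces i ≤ c + 1, where the top is irrelevant.
binomZ-∸-2*suc : ∀ n c i → 2 * i ≤ n + 2 →
  binomZ (n ∸ 2 * c) i (suc c) ≡ binomZ (suc (suc (n ∸ 2 * suc c))) i (suc c)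
binomZ-∸-2*suc n c i 2i≤n+2 with 2 * suc c ≤? n
... | yes 2[c+1]≤n = cong (λ M → binomZ M i (suc c)) top≡
  where
  top≡ : n ∸ 2 * c ≡ suc (suc (n ∸ 2 * suc c))
  top≡ with m≤n⇒∃[o]m+o≡n 2[c+1]≤n
  ... | o , refl = begin
      2 * suc c + o ∸ 2 * c     ≡⟨ cong (_∸ 2 * c) (split c o) ⟩
      2 * c + (2 + o) ∸ 2 * c   ≡⟨ m+n∸m≡n (2 * c) (2 + o) ⟩
      2 + o                     ≡⟨ cong (_+_ 2) (sym (m+n∸m≡n (2 * suc c) o)) ⟩
      2 + (2 * suc c + o ∸ 2 * suc c) ∎
    where
    open ≡-Reasoning
    split : ∀ c o → 2 * suc c + o ≡ 2 * c + (2 + o)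
    split = solve-∀
... | no 2[c+1]≰n = binomZ-top-irrelevant _ _ (≤-pred (*-cancelˡ-< 2 i (suc (suc c)) 2i<2[c+2]))
  where
  2i<2[c+2] : 2 * i < 2 * suc (suc c)
  2i<2[c+2] = ≤-<-trans 2i≤n+2 (subst (n + 2 <_) (shift c) (+-monoˡ-< 2 (≰⇒> 2[c+1]≰n)))
    where
    shift : ∀ c → 2 * suc c + 2 ≡ 2 * suc (suc c)
    shift = solve-∀

C-absorption : ∀ n k → suc k * (suc n C suc k) ≡ suc n * (n C k)
C-absorption zero    zero    = refl
C-absorption zero    (suc k) = *-zeroʳ (suc (suc k))
C-absorption (suc n) zero    rewrite nC1≡n (suc (suc n)) = trans (+-identityʳ _) (sym (*-identityʳ _))
C-absorption (suc n) (suc k) = begin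
    suc (suc k) * (suc (suc n) C suc (suc k))
  ≡⟨ cong (suc (suc k) *_) (sym (nCk+nC[k+1]≡[n+1]C[k+1] (suc n) (suc k))) ⟩
    suc (suc k) * (suc n C suc k + suc n C suc (suc k))
  ≡⟨ split k (suc n C suc k) (suc n C suc (suc k)) ⟩
    suc k * (suc n C suc k) + suc n C suc k + suc (suc k) * (suc n C suc (suc k))
  ≡⟨ cong₂ (λ x y → x + suc n C suc k + y) (C-absorption n k) (C-absorption n (suc k)) ⟩
    suc n * (n C k) + suc n C suc k + suc n * (n C suc k)
  ≡⟨ collect n (n C k) (n C suc k) (suc n C suc k) ⟩
    suc n * (n C k + n C suc k) + suc n C suc k
  ≡⟨ cong (λ x → suc n * x + suc n C suc k) (nCk+nC[k+1]≡[n+1]C[k+1] n k) ⟩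
    suc n * (suc n C suc k) + suc n C suc k
  ≡⟨ +-comm (suc n * (suc n C suc k)) _ ⟩
    suc (suc n) * (suc n C suc k)
  ∎
  where
  open ≡-Reasoning
  split : ∀ k x y → suc (suc k) * (x + y) ≡ suc k * x + x + suc (suc k) * y
  split = solve-∀
  collect : ∀ n a b c → suc n * a + c + suc n * b ≡ suc n * (a + b) + c
  collect = solve-∀

suc-*-C-suc : ∀ k d → suc k * ((k + d) C suc k) ≡ d * ((k + d) C k)
suc-*-C-suc k d = +-cancelˡ-≡ (suc k * (N C k)) _ _ (begin
    suc k * (N C k) + suc k * (N C suc k) ≡⟨ sym (*-distribˡ-+ (suc k) (N C k) (N C suc k)) ⟩
    suc k * (N C k + N C suc k)           ≡⟨ cong (suc k *_) (nCk+nC[k+1]≡[n+1]C[k+1] N k) ⟩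
    suc k * (suc N C suc k)               ≡⟨ C-absorption N k ⟩
    suc N * (N C k)                       ≡⟨ cong (_* (N C k)) (+-comm (suc k) d) ⟩
    (d + suc k) * (N C k)                 ≡⟨ *-distribʳ-+ (N C k) d (suc k) ⟩
    d * (N C k) + suc k * (N C k)         ≡⟨ +-comm (d * (N C k)) _ ⟩
    suc k * (N C k) + d * (N C k)         ∎)
  where
  open ≡-Reasoning
  N = k + d

C-cross-≤ : ∀ k d t s → d * suc t ≤ s * suc k →
            ((t + s) C t) * ((k + d) C suc k) ≤ ((k + d) C k) * ((t + s) C suc t)
C-cross-≤ k d t s d[t+1]≤s[k+1] = *-cancelʳ-≤ _ _ (suc k * suc t) (begin
    a * x * (suc k * suc t)  ≡⟨ pull-k a x (suc k) (suc t) ⟩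
    a * (suc k * x) * suc t  ≡⟨ cong (λ z → a * z * suc t) (suc-*-C-suc k d) ⟩
    a * (d * b) * suc t      ≡⟨ gather a b d (suc t) ⟩
    (a * b) * (d * suc t)    ≤⟨ *-monoʳ-≤ (a * b) d[t+1]≤s[k+1] ⟩
    (a * b) * (s * suc k)    ≡⟨ gather′ a b s (suc k) ⟩
    b * (s * a) * suc k      ≡⟨ cong (λ z → b * z * suc k) (sym (suc-*-C-suc t s)) ⟩
    b * (suc t * y) * suc k  ≡⟨ pull-t b y (suc k) (suc t) ⟩
    b * y * (suc k * suc t)  ∎)
  where
  open ≤-Reasoning
  a = (t + s) C t
  y = (t + s) C suc t
  b = (k + d) C k
  x = (k + d) C suc k
  pull-k : ∀ a x K T → a * x * (K * T) ≡ a * (K * x) * T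
  pull-k = solve-∀
  gather : ∀ a b D T → a * (D * b) * T ≡ (a * b) * (D * T)
  gather = solve-∀
  gather′ : ∀ a b S K → (a * b) * (S * K) ≡ b * (S * a) * K
  gather′ = solve-∀
  pull-t : ∀ b y K T → b * (T * y) * K ≡ b * y * (K * T)
  pull-t = solve-∀

boundary-≤ : ∀ n r k → 2 * k ≤ n →
  binomZ (n ∸ 2 * r) k (suc r) * (suc (suc n) C suc k) ≤ (suc (suc n) C k) * binomZ (n ∸ 2 * r) (suc k) (suc r)
boundary-≤ n r k 2k≤n with suc r ≤? k
... | no r≥k rewrite binomZ-< (n ∸ 2 * r) (≰⇒> r≥k) = z≤n
... | yes r<k with m≤n⇒∃[o]m+o≡n r<k | m≤n⇒∃[o]m+o≡n 2k≤n
... | t , refl | e , 2k+e≡n =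
  subst₂ (λ M N → binomZ M K (suc r) * (N C suc K) ≤ (N C K) * binomZ M (suc K) (suc r))
         (sym top≡) (sym N≡) (begin
    binomZ (t + s) K (suc r) * ((K + d) C suc K)
  ≡⟨ cong (_* ((K + d) C suc K)) (binomZ-+ (t + s) (suc r) t) ⟩
    ((t + s) C t) * ((K + d) C suc K)
  ≤⟨ C-cross-≤ K d t s ratio-≤ ⟩
    ((K + d) C K) * ((t + s) C suc t)
  ≡⟨ cong (((K + d) C K) *_) (sym (trans (cong (λ z → binomZ (t + s) z (suc r)) (sym (+-suc (suc r) t)))
                                        (binomZ-+ (t + s) (suc r) (suc t)))) ⟩
    ((K + d) C K) * binomZ (t + s) (suc K) (suc r)
  ∎)
  where
  open ≤-Reasoning
  K = suc r + t
  s = t + 2 + e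
  d = K + e + 2
  top≡ : n ∸ 2 * r ≡ t + s
  top≡ = trans (cong (_∸ 2 * r) (trans (sym 2k+e≡n) (split r t e))) (m+n∸m≡n (2 * r) (t + s))
    where
    split : ∀ r t e → 2 * (suc r + t) + e ≡ 2 * r + (t + (t + 2 + e))
    split = solve-∀
  N≡ : suc (suc n) ≡ K + d
  N≡ = trans (cong (suc ∘ suc) (sym 2k+e≡n)) (split r t e)
    where
    split : ∀ r t e → suc (suc (2 * (suc r + t) + e)) ≡ (suc r + t) + ((suc r + t) + e + 2)
    split = solve-∀
  ratio-≤ : d * suc t ≤ s * suc K
  ratio-≤ = subst (d * suc t ≤_) (gap r t e) (m≤m+n (d * suc t) (suc r * suc e))
    where
    gap : ∀ r t e → ((suc r + t) + e + 2) * suc t + suc r * suc e ≡ (t + 2 + e) * suc (suc r + t)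
    gap = solve-∀

∸-suc-∸ : ∀ r a → a < r → r ∸ a ≡ suc (r ∸ suc a)
∸-suc-∸ (suc r) zero    _         = refl
∸-suc-∸ (suc r) (suc a) (s≤s a<r) = ∸-suc-∸ r a a<r

module SquareMinusNeighbours (n r : ℕ) where

  -- coef t k a = C(n-2a, k-t-a), the coefficient of u^a in h_{k-t} without the cutoff a ≤ ⌊n/2⌋.
  coef : ℕ → ℕ → ℕ → ℕ
  coef t k a = binomZ (n ∸ 2 * a) k (t + a)

  coef-suc-suc : ∀ t k a → coef (suc t) (suc k) a ≡ coef t k a
  coef-suc-suc t k a = binomZ-suc-suc (n ∸ 2 * a) k (t + a)

  X Y : ℕ → ℕ
  X k = convℕ (coef 0 k) (coef 0 k) r
  Y k = convℕ (coef 1 k) (coef 0 (suc k)) r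

  α β : ℕ → ℕ
  α k = (suc (suc n) C k) * coef 1 (suc k) r
  β k = coef 1 k r * (suc (suc n) C suc k)

  X-Y-step : ∀ j → 2 * suc j ≤ n → Y (suc j) + X j + α (suc j) ≡ X (suc j) + Y j + β (suc j)
  X-Y-step j 2k≤n = begin
      Y k + X j + α k        ≡⟨ cong₂ _+_ (sym ∑left) (sym ω-first) ⟩
      ∑< (suc r) left + ω 0  ≡⟨ ∑<-telescope r left right ω ω′ exchange′ ω′≡ω-next ⟩
      ∑< (suc r) right + ω′ r ≡⟨ cong₂ _+_ ∑right ω′-last ⟩
      X k + Y j + β k        ∎
    where
    open ≡-Reasoning
    k = suc j
    φ ψ : ℕ → ℕ → ℕ
    φ t a = coef t k a
    ψ t a = coef t (suc k) (r ∸ a)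
    Δ² : (ℕ → ℕ → ℕ) → ℕ → ℕ
    Δ² f a = f 0 a + (f 1 a + f 1 a) + f 2 a
    left right ω ω′ : ℕ → ℕ
    left a = φ 1 a * ψ 0 a + φ 1 a * ψ 2 a
    right a = φ 0 a * ψ 1 a + φ 2 a * ψ 1 a
    ω a = Δ² φ a * ψ 1 a
    ω′ a = φ 1 a * Δ² ψ a

    exchange : ∀ p₀ p₁ p₂ q₀ q₁ q₂ →
      (p₁ * q₀ + p₁ * q₂) + (p₀ + (p₁ + p₁) + p₂) * q₁ ≡ (p₀ * q₁ + p₂ * q₁) + p₁ * (q₀ + (q₁ + q₁) + q₂)
    exchange = solve-∀
    exchange′ : ∀ a → left a + ω a ≡ right a + ω′ a
    exchange′ a = exchange (φ 0 a) (φ 1 a) (φ 2 a) (ψ 0 a) (ψ 1 a) (ψ 2 a)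

    2k≤n+2 : 2 * k ≤ n + 2
    2k≤n+2 = ≤-trans 2k≤n (m≤m+n n 2)
    2[k+1]≤n+2 : 2 * suc k ≤ n + 2
    2[k+1]≤n+2 = subst (_≤ n + 2) (shift j) (+-monoˡ-≤ 2 2k≤n)
      where
      shift : ∀ j → 2 * suc j + 2 ≡ 2 * suc (suc j)
      shift = solve-∀

    ω′≡ω-next : ∀ a → a < r → ω′ a ≡ ω (suc a)
    ω′≡ω-next a a<r = begin
        φ 1 a * Δ² ψ a
      ≡⟨ cong (φ 1 a *_) (binomZ-pascal² (n ∸ 2 * (r ∸ a)) (suc k) (r ∸ a)) ⟩
        φ 1 a * binomZ (suc (suc (n ∸ 2 * (r ∸ a)))) (suc k) (r ∸ a)
      ≡⟨ cong₂ _*_ (binomZ-∸-2*suc n a k 2k≤n+2) ψ-side ⟩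
        binomZ (suc (suc (n ∸ 2 * suc a))) k (suc a) * ψ 1 (suc a)
      ≡⟨ cong (_* ψ 1 (suc a)) (sym (binomZ-pascal² (n ∸ 2 * suc a) k (suc a))) ⟩
        ω (suc a)
      ∎
      where
      ψ-side : binomZ (suc (suc (n ∸ 2 * (r ∸ a)))) (suc k) (r ∸ a) ≡ ψ 1 (suc a)
      ψ-side rewrite ∸-suc-∸ r a a<r = sym (binomZ-∸-2*suc n (r ∸ suc a) (suc k) 2[k+1]≤n+2)

    ∑left : ∑< (suc r) left ≡ Y k + X j
    ∑left = trans (∑<-distrib-+ (suc r) (λ a → φ 1 a * ψ 0 a) (λ a → φ 1 a * ψ 2 a))
      (cong (_+_ (Y k)) (∑<-cong (suc r) λ a →
      cong₂ _*_ (coef-suc-suc 0 j a)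
                (trans (coef-suc-suc 1 (suc j) (r ∸ a)) (coef-suc-suc 0 j (r ∸ a)))))

    ∑right : ∑< (suc r) right ≡ X k + Y j
    ∑right = trans (∑<-distrib-+ (suc r) (λ a → φ 0 a * ψ 1 a) (λ a → φ 2 a * ψ 1 a))
      (cong₂ _+_
      (∑<-cong (suc r) λ a → cong (φ 0 a *_) (coef-suc-suc 0 k (r ∸ a)))
      (∑<-cong (suc r) λ a → cong₂ _*_ (coef-suc-suc 1 j a) (coef-suc-suc 0 (suc j) (r ∸ a))))

    ω-first : ω 0 ≡ α k
    ω-first = cong (_* ψ 1 0) (binomZ-pascal² n k 0)

    ω′-last : ω′ r ≡ β k
    ω′-last = cong (φ 1 r *_) (trans (cong (Δ² (λ t → coef t (suc k))) (n∸n≡0 r)) (binomZ-pascal² n (suc k) 0))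

  Y≤X : ∀ k → 2 * k ≤ n → Y k ≤ X k
  Y≤X zero    _     = ∑<-mono-≤ (suc r) {g = λ a → coef 0 0 a * coef 0 0 (r ∸ a)} (λ _ → z≤n)
  Y≤X (suc j) 2k≤n = +-cancelʳ-≤ (X j + α k) (Y k) (X k) (begin
      Y k + (X j + α k)  ≡⟨ sym (+-assoc (Y k) _ _) ⟩
      Y k + X j + α k    ≡⟨ X-Y-step j 2k≤n ⟩
      X k + Y j + β k    ≤⟨ +-monoʳ-≤ (X k + Y j) (boundary-≤ n r k 2k≤n) ⟩
      X k + Y j + α k    ≤⟨ +-monoˡ-≤ (α k) (+-monoʳ-≤ (X k) (Y≤X j (≤-trans (*-monoʳ-≤ 2 (n≤1+n j)) 2k≤n))) ⟩
      X k + X j + α k    ≡⟨ +-assoc (X k) _ _ ⟩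
      X k + (X j + α k)  ∎)
    where
    open ≤-Reasoning
    k = suc j

hCoefℕ : ℕ → ℕ → ℕ → ℕ
hCoefℕ n i j = if (j ≤ᵇ i) ∧ (j ≤ᵇ n / 2) then binomZ (n ∸ 2 * j) i j else 0

hCoef≡+hCoefℕ : ∀ n i j → hCoef n i j ≡ + hCoefℕ n i j
hCoef≡+hCoefℕ n i j with (j ≤ᵇ i) ∧ (j ≤ᵇ n / 2)
... | true  = refl
... | false = refl

hCoefℕ≤binomZ : ∀ n i j → hCoefℕ n i j ≤ binomZ (n ∸ 2 * j) i j
hCoefℕ≤binomZ n i j with (j ≤ᵇ i) ∧ (j ≤ᵇ n / 2)
... | true  = ≤-refl
... | false = z≤n

hCoefℕ≡binomZ : ∀ n i j → i ≤ n / 2 → hCoefℕ n i j ≡ binomZ (n ∸ 2 * j) i j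
hCoefℕ≡binomZ n i j i≤n/2 with j ≤ᵇ i in j≤ᵇi
... | false = refl
... | true with j ≤ᵇ n / 2 in j≤ᵇn/2
...   | true  = refl
...   | false = ⊥-elim (subst T j≤ᵇn/2 (≤⇒≤ᵇ (≤-trans (≤ᵇ⇒≤ j i (subst T (sym j≤ᵇi) tt)) i≤n/2)))

foldr-applyUpTo-+ : ∀ m (h : ℕ → ℕ) {p : ℕ → ℤ.ℤ} (f : ℕ → ℕ) → (∀ a → p a ≡ + f a) →
  foldr ℤ._+_ (+ 0) (map p (applyUpTo h m)) ≡ + ∑< m (f ∘ h)
foldr-applyUpTo-+ zero    h f p≡f = refl
foldr-applyUpTo-+ (suc m) h f p≡f = cong₂ ℤ._+_ (p≡f (h 0)) (foldr-applyUpTo-+ m (h ∘ suc) f p≡f)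

convCoef≡+convℕ : ∀ {p q : ℕ → ℤ.ℤ} (f g : ℕ → ℕ) r →
  (∀ a → p a ≡ + f a) → (∀ a → q a ≡ + g a) → convCoef p q r ≡ + convℕ f g r
convCoef≡+convℕ f g r p≡f q≡g = foldr-applyUpTo-+ (suc r) (λ a → a) (λ a → f a * g (r ∸ a))
  (λ a → trans (cong₂ ℤ._*_ (p≡f a) (q≡g (r ∸ a))) (sym (ℤ.pos-* (f a) (g (r ∸ a)))))

theorem4p2 : (n i r : ℕ) → 1 ≤ i → i ≤ n / 2 → (+ 0) ≤ℤ lcCoef n i r
theorem4p2 n zero    r () _
theorem4p2 n (suc i) r _ i+1≤n/2 =
  ℤ.i≤j⇒0≤j-i (subst₂ _≤ℤ_ (sym outer≡) (sym square≡) (ℤ.+≤+ (≤-trans outer≤Y (Y≤X (suc i) 2[i+1]≤n))))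
  where
  open SquareMinusNeighbours n r
  i≤n/2 : i ≤ n / 2
  i≤n/2 = ≤-trans (n≤1+n i) i+1≤n/2
  2[i+1]≤n : 2 * suc i ≤ n
  2[i+1]≤n = subst (_≤ n) (*-comm (suc i) 2) (≤-trans (*-monoˡ-≤ 2 i+1≤n/2) (m/n*n≤m n 2))
  square≡ : convCoef (hCoef n (suc i)) (hCoef n (suc i)) r ≡ + X (suc i)
  square≡ = convCoef≡+convℕ _ _ r middle≡ middle≡
    where
    middle≡ : ∀ a → hCoef n (suc i) a ≡ + coef 0 (suc i) a
    middle≡ a = trans (hCoef≡+hCoefℕ n (suc i) a) (cong +_ (hCoefℕ≡binomZ n (suc i) a i+1≤n/2))
  outer≡ : convCoef (hCoef n i) (hCoef n (suc (suc i))) r ≡ + convℕ (hCoefℕ n i) (hCoefℕ n (suc (suc i))) r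
  outer≡ = convCoef≡+convℕ _ _ r (hCoef≡+hCoefℕ n i) (hCoef≡+hCoefℕ n (suc (suc i)))
  outer≤Y : convℕ (hCoefℕ n i) (hCoefℕ n (suc (suc i))) r ≤ Y (suc i)
  outer≤Y = ∑<-mono-≤ (suc r) λ a → *-mono-≤
    (≤-reflexive (trans (hCoefℕ≡binomZ n i a i≤n/2) (sym (coef-suc-suc 0 i a))))
    (hCoefℕ≤binomZ n (suc (suc i)) (r ∸ a))
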